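{- For every integer $n\ge2$, $\log^*({}^n2)-\log^{\circledast}({}^n2)\ge\mathrm{slog}(\tfrac{2}{3}n)$.
   Context: All logarithms are base 2, and $\log(x)$ means $\log_2(\max(1,x))$; $\log^{[k]}$ is $k$-fold iteration of $\log$ ($\log^{[0]}$ the identity). For real $\alpha\ge0$, $\log^*(\alpha)$ is the smallest natural number $k$ with $\log^{[k]}(\alpha)\le1$. For real $\alpha>0$, $\log^{\circledast}(\alpha)$ is the largest natural number $k$ with $\log^{[k]}(\alpha)\ge k$; $\log^{\circledast}(0)=0$. Tetration of 2: ${}^02=1$ and ${}^n2=2^{({}^{n-1}2)}$ for $n\ge1$. Fix any extension of $n\mapsto{}^n2$ to a function from the nonnegative reals to $\mathbb{R}^{\ge1}=\{x\in\mathbb{R}:x\ge1\}$ that is increasing and surjective (such extensions exist). $\mathrm{slog}:\mathbb{R}^{\ge1}\to[0,\infty)$ is the inverse of this extended tetration; in particular $\mathrm{slog}({}^n2)=n$ for $n\in\mathbb{N}$. -}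

module Defs where

open import Data.Nat using (ℕ; zero; suc; _+_; _*_; _∸_; _^_; _≤_; _<_)
open import Data.Nat.Logarithm using (⌊log₂_⌋)
open import Function using (_∘_)

tet : ℕ → ℕ
tet zero    = 1
tet (suc n) = 2 ^ tet n

-- log x = log₂ (max 1 x).  We only ever apply it to naturals that are
-- 0, 1 or powers of two (iterated logs of towers), where the floor of the
-- binary logarithm is exact; ⌊log₂ 0⌋ = ⌊log₂ 1⌋ = 0 matches log₂(max 1 x).
lg : ℕ → ℕ
lg = ⌊log₂_⌋

lgIter : ℕ → ℕ → ℕ
lgIter zero    x = x
lgIter (suc k) x = lg (lgIter k x)

IsLogStar : ℕ → ℕ → Set
IsLogStar x k = (lgIter k x ≤ 1) × (∀ j → j < k → 1 < lgIter j x)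
  where open import Data.Product using (_×_)

IsLogCirc : ℕ → ℕ → Set
IsLogCirc x k = (k ≤ lgIter k x) × (∀ j → k < j → lgIter j x < j)
  where open import Data.Product using (_×_)

{-# OPTIONS --safe #-}
-- The iterated logarithms of a tower are again towers: log^[j](ⁿ2) = ⁿ⁻ʲ2 for
-- j ≤ n, and 0 beyond.  Hence log^[a](ⁿ2) ≤ 1 forces n ≤ a, while
-- b ≤ log^[b](ⁿ2) forces b ≤ n and b ≤ ᵐ2 for m = n − b.  Since 2m ≤ ᵐ2,
-- 2n = 2b + 2m ≤ 3·ᵐ2 ≤ 3·ᵃ⁻ᵇ2, i.e. slog(2n/3) ≤ a − b.
module Submission where

open import Defs
open import Data.Nat using (ℕ; zero; suc; _+_; _*_; _∸_; _^_; _≤_; _<_; z≤n; s≤s; z<s)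
open import Data.Nat.Properties
open import Data.Nat.Logarithm using (⌊log₂[2^n]⌋≡n)
open import Data.Product using (_×_; _,_)
open import Relation.Binary.PropositionalEquality using (_≡_; refl; sym; trans; cong; subst; module ≡-Reasoning)
open import Function using (_∘_)

n<2^n : ∀ n → n < 2 ^ n
n<2^n zero    = z<s
n<2^n (suc n) = ≤-<-trans (n<2^n n) (^-monoʳ-< 2 (s≤s (s≤s z≤n)) (n<1+n n))

2*n≤2^n : ∀ n → 2 * n ≤ 2 ^ n
2*n≤2^n zero          = z≤n
2*n≤2^n (suc zero)    = ≤-refl
2*n≤2^n (suc (suc n)) = begin
  2 * suc (suc n)        ≡⟨ *-distribˡ-+ 2 1 (suc n) ⟩
  2 + 2 * suc n          ≤⟨ +-monoˡ-≤ (2 * suc n) (*-monoʳ-≤ 2 (s≤s (z≤n {n}))) ⟩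
  2 * suc n + 2 * suc n  ≤⟨ +-mono-≤ (2*n≤2^n (suc n)) (2*n≤2^n (suc n)) ⟩
  2 ^ suc n + 2 ^ suc n  ≡⟨ cong (2 ^ suc n +_) (sym (+-identityʳ (2 ^ suc n))) ⟩
  2 ^ suc (suc n)        ∎
  where open ≤-Reasoning

n<tet[n] : ∀ n → n < tet n
n<tet[n] zero    = z<s
n<tet[n] (suc n) = ≤-<-trans (n<tet[n] n) (n<2^n (tet n))

2*n≤tet[n] : ∀ n → 2 * n ≤ tet n
2*n≤tet[n] zero    = z≤n
2*n≤tet[n] (suc n) = ≤-trans (*-monoʳ-≤ 2 (n<tet[n] n)) (2*n≤2^n (tet n))

tet-mono-≤ : ∀ {m n} → m ≤ n → tet m ≤ tet n
tet-mono-≤ {n = n} z≤n = ≤-<-trans z≤n (n<tet[n] n)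
tet-mono-≤ (s≤s m≤n)   = ^-monoʳ-≤ 2 (tet-mono-≤ m≤n)

2*[k+m]≤3*tet[m] : ∀ k m → k ≤ tet m → 2 * (k + m) ≤ 3 * tet m
2*[k+m]≤3*tet[m] k m k≤tet[m] = begin
  2 * (k + m)        ≡⟨ *-distribˡ-+ 2 k m ⟩
  2 * k + 2 * m      ≤⟨ +-mono-≤ (*-monoʳ-≤ 2 k≤tet[m]) (2*n≤tet[n] m) ⟩
  2 * tet m + tet m  ≡⟨ +-comm (2 * tet m) (tet m) ⟩
  3 * tet m          ∎
  where open ≤-Reasoning

lgIter-suc : ∀ j x → lgIter (suc j) x ≡ lgIter j (lg x)
lgIter-suc zero    x = refl
lgIter-suc (suc j) x = cong lg (lgIter-suc j x)

lgIter-+ : ∀ k j x → lgIter (k + j) x ≡ lgIter k (lgIter j x)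
lgIter-+ zero    j x = refl
lgIter-+ (suc k) j x = cong lg (lgIter-+ k j x)

lgIter-zero : ∀ k → lgIter k 0 ≡ 0
lgIter-zero zero    = refl
lgIter-zero (suc k) = cong lg (lgIter-zero k)

lgIter-tet : ∀ j m → lgIter j (tet (j + m)) ≡ tet m
lgIter-tet zero    m = refl
lgIter-tet (suc j) m = trans (lgIter-suc j (2 ^ tet (j + m)))
  (trans (cong (lgIter j) (⌊log₂[2^n]⌋≡n (tet (j + m)))) (lgIter-tet j m))

lgIter-tet-∸ : ∀ {j n} → j ≤ n → lgIter j (tet n) ≡ tet (n ∸ j)
lgIter-tet-∸ {j} {n} j≤n =
  subst (λ t → lgIter j (tet t) ≡ tet (n ∸ j)) (m+[n∸m]≡n j≤n) (lgIter-tet j (n ∸ j))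

lgIter-one : ∀ {k} → 0 < k → lgIter k 1 ≡ 0
lgIter-one {suc k} _ = trans (lgIter-suc k 1) (lgIter-zero k)

lgIter-tet-overshoot : ∀ {j n} → n < j → lgIter j (tet n) ≡ 0
lgIter-tet-overshoot {j} {n} n<j = begin
  lgIter j (tet n)                  ≡⟨ cong (λ i → lgIter i (tet n)) (sym (m∸n+n≡m (<⇒≤ n<j))) ⟩
  lgIter (j ∸ n + n) (tet n)        ≡⟨ lgIter-+ (j ∸ n) n (tet n) ⟩
  lgIter (j ∸ n) (lgIter n (tet n)) ≡⟨ cong (lgIter (j ∸ n)) (lgIter-tet-∸ (≤-refl {n})) ⟩
  lgIter (j ∸ n) (tet (n ∸ n))      ≡⟨ cong (lgIter (j ∸ n) ∘ tet) (n∸n≡0 n) ⟩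
  lgIter (j ∸ n) 1                  ≡⟨ lgIter-one (m<n⇒0<n∸m n<j) ⟩
  0                                 ∎
  where open ≡-Reasoning

lgIter-tet≤1⇒n≤k : ∀ {k n} → lgIter k (tet n) ≤ 1 → n ≤ k
lgIter-tet≤1⇒n≤k bounded = ≮⇒≥ λ k<n → <⇒≱
  (≤-trans (tet-mono-≤ (m<n⇒0<n∸m k<n)) (≤-reflexive (sym (lgIter-tet-∸ (<⇒≤ k<n)))))
  bounded

k≤lgIter-tet⇒k≤n : ∀ {k n} → k ≤ lgIter k (tet n) → k ≤ n
k≤lgIter-tet⇒k≤n {k} bounded = ≮⇒≥ λ n<k →
  <⇒≱ (≤-<-trans z≤n n<k) (subst (k ≤_) (lgIter-tet-overshoot n<k) bounded)

theorem4p20 : (n a b : ℕ) → 2 ≤ n → IsLogStar (tet n) a → IsLogCirc (tet n) b →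
    (b ≤ a) × (2 * n ≤ 3 * tet (a ∸ b))
theorem4p20 n a b _ (log*-bound , _) (log⊛-bound , _) = ≤-trans b≤n n≤a , (begin
  2 * n                  ≡⟨ cong (2 *_) (sym (m+[n∸m]≡n b≤n)) ⟩
  2 * (b + (n ∸ b))      ≤⟨ 2*[k+m]≤3*tet[m] b (n ∸ b) b≤tet[n∸b] ⟩
  3 * tet (n ∸ b)        ≤⟨ *-monoʳ-≤ 3 (tet-mono-≤ (∸-monoˡ-≤ b n≤a)) ⟩
  3 * tet (a ∸ b)        ∎)
  where
    open ≤-Reasoning
    n≤a : n ≤ a
    n≤a = lgIter-tet≤1⇒n≤k log*-bound
    b≤n : b ≤ n
    b≤n = k≤lgIter-tet⇒k≤n log⊛-bound
    b≤tet[n∸b] : b ≤ tet (n ∸ b)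
    b≤tet[n∸b] = subst (b ≤_) (lgIter-tet-∸ b≤n) log⊛-bound
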